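{- Let $a\geq 3$ and $m\geq 2a^2-a+2$ be integers and let $C(m,a)=\left\lceil\frac{m-1}{a}\left\lceil\frac{m-1}{a}\right\rceil\right\rceil$. Then every coloring of $[C(m,a)]=\{1,\ldots,C(m,a)\}$ with the two colors red and blue in which both $a-2$ and $a-1$ are red admits a monochromatic solution of $x_1+x_2+\cdots+x_{m-1}=ax_m$.
   Context: A solution in $[n]$ is an assignment of values in $[n]$ to $x_1,\ldots,x_m$ (not necessarily distinct) making the equation true; it is monochromatic if all the values $x_1,\ldots,x_m$ have the same color. -}

module Defs where

open import Data.Nat using (ℕ; _+_; _*_; _∸_; _≤_; NonZero)
open import Data.Nat.DivMod using (_/_)
open import Data.Fin using (Fin)
open import Data.Bool using (Bool)
open import Data.Product using (Σ; _×_; ∃)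
open import Relation.Binary.PropositionalEquality using (_≡_)

⌈_/_⌉ : (p q : ℕ) → .{{NonZero q}} → ℕ
⌈ p / q ⌉ = (p + q ∸ 1) / q

-- C(m,a) = ⌈ ((m-1)/a) ⌈ (m-1)/a ⌉ ⌉ = ⌈ (m-1) * ⌈(m-1)/a⌉ / a ⌉
C : (m a : ℕ) → .{{NonZero a}} → ℕ
C m a = ⌈ (m ∸ 1) * ⌈ (m ∸ 1) / a ⌉ / a ⌉

data Colour : Set where
  red blue : Colour

sumFin : (n : ℕ) → (Fin n → ℕ) → ℕ
sumFin Data.Nat.zero f = 0
sumFin (Data.Nat.suc n) f = f Fin.zero + sumFin n (λ i → f (Fin.suc i))

-- a monochromatic solution in [N] of x₁ + ... + x_{m-1} = a·x_m, under colouring c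
-- (xs i is x_{i+1} for i < m-1, y is x_m); the colouring only matters on [N]
MonoSolution : (N m a : ℕ) → (ℕ → Colour) → Set
MonoSolution N m a c =
  Σ (Fin (m ∸ 1) → ℕ) λ xs → Σ ℕ λ y → Σ Colour λ col →
    ((i : Fin (m ∸ 1)) → (1 ≤ xs i) × (xs i ≤ N) × (c (xs i) ≡ col)) ×
    (1 ≤ y) × (y ≤ N) × (c y ≡ col) ×
    (sumFin (m ∸ 1) xs ≡ a * y)

module Submission where

open import Defs
open import Data.Nat using (ℕ; zero; suc; _+_; _*_; _∸_; _≤_; _<_; z≤n; s≤s; NonZero; _≤?_)
open import Data.Nat.Properties
open import Data.Nat.DivMod using (_/_; _%_; m≡m%n+[m/n]*n; m%n<n)
open import Data.Nat.Tactic.RingSolver using (solve-∀)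
open import Data.Fin using (Fin)
open import Data.Product using (Σ; _×_; _,_; proj₁; proj₂)
open import Data.Sum using (_⊎_; inj₁; inj₂; [_,_]′)
open import Function using (id)
open import Relation.Binary.PropositionalEquality
open import Relation.Nullary using (Dec; yes; no; contradiction)

-- Write n = m − 1, k = ⌈n/a⌉ and N = C(m, a) = ⌈n·k/a⌉.  All
-- solutions are assembled from one combinatorial fact (`interval`): every T with
-- p·u ≤ T ≤ p·w is a sum of p numbers from [u, w].  Consequently, if [u, w] is
-- monochromatic then any z of the same colour with n·u ≤ a·z ≤ n·w closes a
-- monochromatic solution (`forced`), as does any y of that colour which is a
-- sum of n − (a − 1) numbers from [u, w], since a·y = (a − 1)·y + y (`selfSum`).
-- Step 0: as a − 2 and a − 1 are red, every z with n(a − 2) ≤ a·z ≤ n(a − 1) is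
-- blue.  Then split on the least blue b < k (`Main.result`):
--   * none: N, according to its colour, is handled by [1, k − 1] or [k, k + 1];
--   * a ≤ b: a suitable y = ⌈((n − 1)·b + k)/a⌉ gives a solution (`LargeFirstBlue`);
--   * b ≤ a − 3: n − p copies of b plus p numbers of the blue window (`SmallBlue`);
--   * b ∈ {a − 2, a − 1} is impossible.

data SumOf (P : ℕ → Set) : ℕ → ℕ → Set where
  []   : SumOf P 0 0
  cons : ∀ {p T} x → P x → SumOf P p T → SumOf P (suc p) (x + T)

module _ {P : ℕ → Set} where

  castSum : ∀ {p q T U} → p ≡ q → T ≡ U → SumOf P p T → SumOf P q U
  castSum refl refl s = s

  replicate : ∀ p {v} → P v → SumOf P p (p * v)
  replicate zero    pv = []
  replicate (suc p) pv = cons _ pv (replicate p pv)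

  _++_ : ∀ {p q T U} → SumOf P p T → SumOf P q U → SumOf P (p + q) (T + U)
  [] ++ s′ = s′
  _++_ {U = U} (cons {T = T} x px s) s′ = castSum refl (sym (+-assoc x T U)) (cons x px (s ++ s′))

  mapSum : ∀ {Q : ℕ → Set} {p T} → (∀ {x} → P x → Q x) → SumOf P p T → SumOf Q p T
  mapSum f []            = []
  mapSum f (cons x px s) = cons x (f px) (mapSum f s)

  refine : ∀ {Q : ℕ → Set} {E : Set} {p T} →
           (∀ x → P x → Q x ⊎ E) → SumOf P p T → SumOf Q p T ⊎ E
  refine f [] = inj₁ []
  refine f (cons x px s) with f x px | refine f s
  ... | inj₂ e  | _       = inj₂ e
  ... | inj₁ qx | inj₂ e  = inj₂ e
  ... | inj₁ qx | inj₁ s′ = inj₁ (cons x qx s′)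

  summands : ∀ {p T} → SumOf P p T → Fin p → ℕ
  summands (cons x px s) Fin.zero    = x
  summands (cons x px s) (Fin.suc i) = summands s i

  summands-satisfy : ∀ {p T} (s : SumOf P p T) i → P (summands s i)
  summands-satisfy (cons x px s) Fin.zero    = px
  summands-satisfy (cons x px s) (Fin.suc i) = summands-satisfy s i

  summands-sum : ∀ {p T} (s : SumOf P p T) → sumFin p (summands s) ≡ T
  summands-sum []            = refl
  summands-sum (cons x px s) = cong (x +_) (summands-sum s)

Between : ℕ → ℕ → ℕ → Set
Between u w z = (u ≤ z) × (z ≤ w)

-- Greedily, the first summand is u if the rest can still reach T, and
-- otherwise T − q·w with all remaining summands equal to w.
interval : ∀ p {u w T} → p * u ≤ T → T ≤ p * w → SumOf (Between u w) p T
interval zero    {T = T} _ T≤0 = castSum refl (sym (n≤0⇒n≡0 T≤0)) []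
interval (suc q) {u} {w} {T} lo hi = split (T ≤? u + q * w)
  where
  u≤w : u ≤ w
  u≤w = *-cancelˡ-≤ (suc q) (≤-trans lo hi)
  split : Dec (T ≤ u + q * w) → SumOf (Between u w) (suc q) T
  split (yes T≤u+qw) = castSum refl (m+[n∸m]≡n (m+n≤o⇒m≤o u lo))
                         (cons u (≤-refl , u≤w) (interval q qu≤T∸u (m≤n+o⇒m∸n≤o T u T≤u+qw)))
    where
    qu≤T∸u : q * u ≤ T ∸ u
    qu≤T∸u = m+n≤o⇒m≤o∸n (q * u) (≤-trans (≤-reflexive (+-comm (q * u) u)) lo)
  split (no T≰u+qw) = castSum refl (m∸n+n≡m (m+n≤o⇒n≤o u (<⇒≤ u+qw<T)))
                         (cons (T ∸ q * w) (u≤T∸qw , T∸qw≤w) (interval q (*-monoʳ-≤ q u≤w) ≤-refl))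
    where
    u+qw<T : u + q * w < T
    u+qw<T = ≰⇒> T≰u+qw
    u≤T∸qw : u ≤ T ∸ q * w
    u≤T∸qw = m+n≤o⇒m≤o∸n u (<⇒≤ u+qw<T)
    T∸qw≤w : T ∸ q * w ≤ w
    T∸qw≤w = m≤n+o⇒m∸n≤o T (q * w) (≤-trans hi (≤-reflexive (+-comm w (q * w))))

floor-spec : ∀ S q .{{_ : NonZero q}} → q * (S / q) ≤ S × S < q * (S / q) + q
floor-spec S q = lower , upper
  where
  open ≤-Reasoning
  division : S ≡ S % q + S / q * q
  division = m≡m%n+[m/n]*n S q
  lower : q * (S / q) ≤ S
  lower = begin
    q * (S / q)         ≡⟨ *-comm q (S / q) ⟩
    S / q * q           ≤⟨ m≤n+m (S / q * q) (S % q) ⟩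
    S % q + S / q * q   ≡⟨ division ⟨
    S                   ∎
  upper : S < q * (S / q) + q
  upper = begin-strict
    S                   ≡⟨ division ⟩
    S % q + S / q * q   <⟨ +-monoˡ-< (S / q * q) (m%n<n S q) ⟩
    q + S / q * q       ≡⟨ +-comm q (S / q * q) ⟩
    S / q * q + q       ≡⟨ cong (_+ q) (*-comm (S / q) q) ⟩
    q * (S / q) + q     ∎

ceil-spec : ∀ x q .{{_ : NonZero q}} → x ≤ q * ⌈ x / q ⌉ × q * ⌈ x / q ⌉ < x + q
ceil-spec x q@(suc q′) = lower , upper
  where
  open ≤-Reasoning
  shifted : x + q ∸ 1 ≡ x + q′
  shifted = +-∸-assoc x {q} {1} (s≤s z≤n)
  floor : q * ⌈ x / q ⌉ ≤ x + q′ × x + q′ < q * ⌈ x / q ⌉ + q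
  floor = subst (λ S → q * ⌈ x / q ⌉ ≤ S × S < q * ⌈ x / q ⌉ + q) shifted (floor-spec (x + q ∸ 1) q)
  lower : x ≤ q * ⌈ x / q ⌉
  lower = +-cancelʳ-≤ q′ x (q * ⌈ x / q ⌉) (≤-pred (≤-trans (proj₂ floor) (≤-reflexive (+-suc _ q′))))
  upper : q * ⌈ x / q ⌉ < x + q
  upper = begin-strict
    q * ⌈ x / q ⌉  ≤⟨ proj₁ floor ⟩
    x + q′         <⟨ +-monoʳ-< x (n<1+n q′) ⟩
    x + q          ∎

≤-via-slack : ∀ {m n} d → m + d ≡ n → m ≤ n
≤-via-slack {m} d refl = m≤m+n m d

positive-factor : ∀ a {x y} → 1 ≤ x → x ≤ a * y → 1 ≤ y
positive-factor a {y = zero}  1≤x x≤0 = contradiction (≤-trans 1≤x (≤-trans x≤0 (≤-reflexive (*-zeroʳ a)))) λ ()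
positive-factor a {y = suc y} _   _   = s≤s z≤n

drop-one-row : ∀ n k → k ≤ n → n * k ≤ (n ∸ 1) * k + n
drop-one-row zero     k _   = z≤n
drop-one-row (suc n₁) k k≤n = ≤-trans (≤-reflexive (+-comm k (n₁ * k))) (+-monoʳ-≤ (n₁ * k) k≤n)

tail-bound : ∀ {n a B} → 1 ≤ n → 3 ≤ B → a ≤ B → (n ∸ 1) * B + n + a ≤ 2 * n * (B ∸ 1) + 1
tail-bound {suc n₁} {a} {suc (suc (suc β))} _ (s≤s (s≤s (s≤s z≤n))) a≤B = begin
  n₁ * (3 + β) + suc n₁ + a        ≤⟨ +-monoʳ-≤ (n₁ * (3 + β) + suc n₁) a≤B ⟩
  n₁ * (3 + β) + suc n₁ + (3 + β)  ≤⟨ ≤-via-slack (n₁ * β + β + 1) (identity n₁ β) ⟩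
  2 * suc n₁ * (2 + β) + 1         ∎
  where
  open ≤-Reasoning
  identity : ∀ n₁ β → n₁ * (3 + β) + suc n₁ + (3 + β) + (n₁ * β + β + 1) ≡ 2 * suc n₁ * (2 + β) + 1
  identity = solve-∀

double-bound : ∀ {a d c} → 3 ≤ a → 2 * d ≤ c → 2 * (d + c) ≤ a * c
double-bound {a} {d} {c} 3≤a 2d≤c = begin
  2 * (d + c)      ≡⟨ *-distribˡ-+ 2 d c ⟩
  2 * d + 2 * c    ≤⟨ +-monoˡ-≤ (2 * c) 2d≤c ⟩
  3 * c            ≤⟨ *-monoˡ-≤ c 3≤a ⟩
  a * c            ∎
  where open ≤-Reasoning

weighted-bound : ∀ {b r s n} → b + r ≡ s → 2 * (2 + s) * suc s ≤ n →
                 (2 + s) * suc r * b + suc r * suc s + (2 + s) * suc s ≤ suc b * n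
weighted-bound {b} {r} {_} {n} refl 2A[A-1]≤n = begin
  A * p * b + p * d + A * d        ≤⟨ +-mono-≤ (+-monoʳ-≤ (A * p * b) (*-monoʳ-≤ p (n≤1+n d))) (m≤m*n (A * d) (suc b)) ⟩
  A * p * b + p * A + A * d * suc b ≡⟨ regroup A p d b ⟩
  suc b * (A * (p + d))             ≤⟨ *-monoʳ-≤ (suc b) (*-monoʳ-≤ A (+-monoˡ-≤ d p≤d)) ⟩
  suc b * (A * (d + d))             ≡⟨ cong (suc b *_) (double A d) ⟩
  suc b * (2 * A * d)               ≤⟨ *-monoʳ-≤ (suc b) 2A[A-1]≤n ⟩
  suc b * n                         ∎
  where
  open ≤-Reasoning
  A = 2 + (b + r)
  p = suc r
  d = suc (b + r)
  p≤d : p ≤ d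
  p≤d = s≤s (m≤n+m r b)
  regroup : ∀ A p d b → A * p * b + p * A + A * d * suc b ≡ suc b * (A * (p + d))
  regroup = solve-∀
  double : ∀ A d → A * (d + d) ≡ 2 * A * d
  double = solve-∀

-- Both sides differ by (b + 1)·n minus the left side of `weighted-bound`.
balance : ∀ {s b r n n′} → b + r ≡ s → n′ + suc r ≡ n → 2 * (2 + s) * suc s ≤ n →
          (2 + s) * (n * s + suc s) + suc r * (n + suc s) ≤ (2 + s) * (n′ * b) + suc r * ((2 + s) * n)
balance {b = b} {r} {n′ = n′} refl refl 2A[A-1]≤n =
  +-cancelʳ-≤ (suc b * n) _ _ (begin
    lhs + suc b * n  ≡⟨ identity b r n′ ⟩
    rhs + excess     ≤⟨ +-monoʳ-≤ rhs (weighted-bound {b} {r} refl 2A[A-1]≤n) ⟩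
    rhs + suc b * n  ∎)
  where
  open ≤-Reasoning
  s = b + r
  n = n′ + suc r
  lhs = (2 + s) * (n * s + suc s) + suc r * (n + suc s)
  rhs = (2 + s) * (n′ * b) + suc r * ((2 + s) * n)
  excess = (2 + s) * suc r * b + suc r * suc s + (2 + s) * suc s
  identity : ∀ b r n′ →
    (2 + (b + r)) * ((n′ + suc r) * (b + r) + suc (b + r)) + suc r * ((n′ + suc r) + suc (b + r)) + suc b * (n′ + suc r) ≡
    (2 + (b + r)) * (n′ * b) + suc r * ((2 + (b + r)) * (n′ + suc r)) +
    ((2 + (b + r)) * suc r * b + suc r * suc (b + r) + (2 + (b + r)) * suc (b + r))
  identity = solve-∀

last-row : ∀ {n b k a} → b < k → a < n → (n ∸ 1) * b + k + a ≤ n * k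
last-row {suc n₁} {b} {suc k₁} {a} (s≤s b≤k₁) (s≤s a≤n₁) = begin
  n₁ * b + suc k₁ + a      ≤⟨ +-mono-≤ (+-monoˡ-≤ (suc k₁) (*-monoʳ-≤ n₁ b≤k₁)) a≤n₁ ⟩
  n₁ * k₁ + suc k₁ + n₁    ≡⟨ identity n₁ k₁ ⟩
  suc n₁ * suc k₁          ∎
  where
  open ≤-Reasoning
  identity : ∀ n₁ k₁ → n₁ * k₁ + suc k₁ + n₁ ≡ suc n₁ * suc k₁
  identity = solve-∀

below-pred : ∀ {b k} → 1 ≤ k → b ≤ k ∸ 1 → b < k
below-pred {k = suc k₁} _ b≤k₁ = s≤s b≤k₁

shift-bound : ∀ {a m x} → a ≤ x → x ∸ a + 2 ≤ m → x + 1 ≤ (m ∸ 1) + a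
shift-bound {a} {m} {x} a≤x x-a+2≤m = begin
  x + 1              ≡⟨ cong (_+ 1) (m∸n+n≡m a≤x) ⟨
  x ∸ a + a + 1      ≡⟨ swap (x ∸ a) a ⟩
  x ∸ a + 1 + a      ≤⟨ +-monoˡ-≤ a (m+n≤o⇒m≤o∸n (x ∸ a + 1) (≤-trans (≤-reflexive (+-assoc (x ∸ a) 1 1)) x-a+2≤m)) ⟩
  m ∸ 1 + a          ∎
  where
  open ≤-Reasoning
  swap : ∀ t a → t + a + 1 ≡ t + 1 + a
  swap = solve-∀

other : Colour → Colour
other red  = blue
other blue = red

dichotomy : ∀ x col → x ≡ col ⊎ x ≡ other col
dichotomy red  red  = inj₁ refl
dichotomy red  blue = inj₂ refl
dichotomy blue red  = inj₂ refl
dichotomy blue blue = inj₁ refl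

module Colouring (N n a : ℕ) (c : ℕ → Colour) where

  Good : Colour → ℕ → Set
  Good col z = (1 ≤ z) × (z ≤ N) × (c z ≡ col)

  Solution : Set
  Solution = Σ Colour λ col → Σ ℕ λ y → Good col y × SumOf (Good col) n (a * y)

  Uniform : Colour → ℕ → ℕ → Set
  Uniform col u w = ∀ z → Between u w z → Good col z

  uniform : ∀ {col u w} → (∀ z → Between u w z → c z ≡ col) → 1 ≤ u → w ≤ N → Uniform col u w
  uniform same 1≤u w≤N z z∈ = ≤-trans 1≤u (proj₁ z∈) , ≤-trans (proj₂ z∈) w≤N , same z z∈

  forced : ∀ {col u w z} → Uniform col u w → Good col z → n * u ≤ a * z → a * z ≤ n * w → Solution
  forced {col} {z = z} uni gz lo hi = col , z , gz , mapSum (uni _) (interval n lo hi)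

  opposite : ∀ {col u w z} → Uniform col u w → 1 ≤ z → z ≤ N →
             n * u ≤ a * z → a * z ≤ n * w → Good (other col) z ⊎ Solution
  opposite {col} {z = z} uni 1≤z z≤N lo hi with dichotomy (c z) col
  ... | inj₁ same = inj₂ (forced uni (1≤z , z≤N , same) lo hi)
  ... | inj₂ diff = inj₁ (1≤z , z≤N , diff)

  selfSum : ∀ {col u w y d cnt} → suc d ≡ a → d + cnt ≡ n → Uniform col u w → Good col y →
            cnt * u ≤ y → y ≤ cnt * w → Solution
  selfSum {col} {y = y} {d} {cnt} refl lengths uni gy lo hi =
    col , y , gy , castSum lengths (+-comm (d * y) y) (replicate d gy ++ mapSum (uni _) (interval cnt lo hi))

  firstBlue : ∀ j → (∀ z → Between 1 j z → c z ≡ red) ⊎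
              Σ ℕ λ b → Between 1 j b × c b ≡ blue × (∀ z → Between 1 (b ∸ 1) z → c z ≡ red)
  firstBlue zero = inj₁ λ { z (1≤z , z≤0) → contradiction (≤-trans 1≤z z≤0) λ () }
  firstBlue (suc j) with firstBlue j
  ... | inj₂ (b , (1≤b , b≤j) , blue-b , below) = inj₂ (b , (1≤b , m≤n⇒m≤1+n b≤j) , blue-b , below)
  ... | inj₁ allRed with c (suc j) in eq
  ...   | blue = inj₂ (suc j , (s≤s z≤n , ≤-refl) , eq , allRed)
  ...   | red  = inj₁ λ z (1≤z , z≤1+j) → extend z 1≤z (m≤n⇒m<n∨m≡n z≤1+j)
    where
    extend : ∀ z → 1 ≤ z → z < suc j ⊎ z ≡ suc j → c z ≡ red
    extend z 1≤z (inj₁ z<1+j) = allRed z (1≤z , ≤-pred z<1+j)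
    extend z 1≤z (inj₂ refl)  = eq

toMonoSolution : ∀ {N m a c} → Colouring.Solution N (m ∸ 1) a c → MonoSolution N m a c
toMonoSolution (col , y , (1≤y , y≤N , cy) , s) =
  summands s , y , col , summands-satisfy s , 1≤y , y≤N , cy , summands-sum s

-- The theorem for a = α + 3, n = m − 1, k = ⌈n/a⌉ and N = ⌈n·k/a⌉, the last
-- two given through the inequalities characterising them.
module Main (α n k N : ℕ) (c : ℕ → Colour)
  (n-large : 2 * (3 + α) * (3 + α) + 1 ≤ n + (3 + α))
  (k-lower : n ≤ (3 + α) * k) (k-upper : (3 + α) * k < n + (3 + α))
  (N-lower : n * k ≤ (3 + α) * N) (N-upper : (3 + α) * N < n * k + (3 + α))
  (red₁ : c (suc α) ≡ red) (red₂ : c (suc (suc α)) ≡ red) where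

  a : ℕ
  a = 3 + α

  open Colouring N n a c

  a²+a<n : a * a + a < n
  a²+a<n = +-cancelʳ-≤ a (suc (a * a + a)) n (begin
    suc (a * a + a) + a   ≡⟨ regroup a ⟩
    a * a + 2 * a + 1     ≤⟨ +-monoˡ-≤ 1 (+-monoʳ-≤ (a * a) (*-monoˡ-≤ a {2} {a} (s≤s (s≤s z≤n)))) ⟩
    a * a + a * a + 1     ≡⟨ double a ⟩
    2 * a * a + 1         ≤⟨ n-large ⟩
    n + a                 ∎)
    where
    open ≤-Reasoning
    regroup : ∀ x → suc (x * x + x) + x ≡ x * x + 2 * x + 1
    regroup = solve-∀
    double : ∀ x → x * x + x * x + 1 ≡ 2 * x * x + 1
    double = solve-∀

  2a[a-1]≤n : 2 * a * suc (suc α) ≤ n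
  2a[a-1]≤n = +-cancelʳ-≤ a (2 * a * suc (suc α)) n (begin
      2 * a * suc (suc α) + a      ≤⟨ m≤m+n (2 * a * suc (suc α) + a) a ⟩
      2 * a * suc (suc α) + a + a  ≡⟨ square (suc (suc α)) ⟩
      2 * a * a                    ≤⟨ m≤m+n (2 * a * a) 1 ⟩
      2 * a * a + 1                ≤⟨ n-large ⟩
      n + a                        ∎)
    where
    open ≤-Reasoning
    square : ∀ d → 2 * suc d * d + suc d + suc d ≡ 2 * suc d * suc d
    square = solve-∀

  -- k ≥ 2a: otherwise n + a ≤ a·(k + 1) ≤ 2a², against the hypothesis on n.
  2a≤k : 2 * a ≤ k
  2a≤k with 2 * a ≤? k
  ... | yes 2a≤k = 2a≤k
  ... | no 2a≰k = contradiction (≤-trans (≤-trans (≤-reflexive (+-comm 1 (2 * a * a))) n-large) n+a≤2a²) (1+n≰n)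
    where
    open ≤-Reasoning
    n+a≤2a² : n + a ≤ 2 * a * a
    n+a≤2a² = begin
      n + a           ≤⟨ +-monoˡ-≤ a k-lower ⟩
      a * k + a       ≡⟨ +-comm (a * k) a ⟩
      a + a * k       ≡⟨ *-suc a k ⟨
      a * suc k       ≤⟨ *-monoʳ-≤ a (≰⇒> 2a≰k) ⟩
      a * (2 * a)     ≡⟨ *-comm a (2 * a) ⟩
      2 * a * a       ∎

  3≤k : 3 ≤ k
  3≤k = ≤-trans (s≤s (s≤s (s≤s z≤n))) 2a≤k

  a≤k : a ≤ k
  a≤k = ≤-trans (m≤m+n a (a + 0)) 2a≤k

  a[k+a]≤2n : a * (k + a) ≤ 2 * n
  a[k+a]≤2n = <⇒≤ (begin-strict
      a * (k + a)       ≡⟨ *-distribˡ-+ a k a ⟩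
      a * k + a * a     <⟨ +-monoˡ-< (a * a) k-upper ⟩
      n + a + a * a     ≡⟨ +-assoc n a (a * a) ⟩
      n + (a + a * a)   ≡⟨ cong (n +_) (+-comm a (a * a)) ⟩
      n + (a * a + a)   <⟨ +-monoʳ-< n a²+a<n ⟩
      n + n             ≡⟨ cong (n +_) (+-identityʳ n) ⟨
      2 * n             ∎)
    where open ≤-Reasoning

  k+a≤n : k + a ≤ n
  k+a≤n = *-cancelˡ-≤ a (≤-trans a[k+a]≤2n (*-monoˡ-≤ n {2} {a} (s≤s (s≤s z≤n))))

  n≤N : n ≤ N
  n≤N = *-cancelˡ-≤ a (begin
      a * n    ≤⟨ *-monoˡ-≤ n a≤k ⟩
      k * n    ≡⟨ *-comm k n ⟩
      n * k    ≤⟨ N-lower ⟩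
      a * N    ∎)
    where open ≤-Reasoning

  1≤k : 1 ≤ k
  1≤k = ≤-trans (s≤s z≤n) 3≤k

  k≤n : k ≤ n
  k≤n = ≤-trans (m≤m+n k a) k+a≤n

  a<n : a < n
  a<n = ≤-trans (+-monoˡ-≤ a 1≤k) k+a≤n

  1≤n : 1 ≤ n
  1≤n = ≤-trans 1≤k k≤n

  k+a≤N : k + a ≤ N
  k+a≤N = ≤-trans k+a≤n n≤N

  a≤N : a ≤ N
  a≤N = ≤-trans (m≤n+m a k) k+a≤N

  1≤N : 1 ≤ N
  1≤N = ≤-trans 1≤n n≤N

  redPair : Uniform red (suc α) (suc (suc α))
  redPair = uniform red-at (s≤s z≤n) (≤-trans (n≤1+n (2 + α)) a≤N)
    where
    red-at : ∀ z → Between (suc α) (suc (suc α)) z → c z ≡ red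
    red-at z (α<z , z≤α+2) with m≤n⇒m<n∨m≡n z≤α+2
    ... | inj₁ z<α+2 = subst (λ t → c t ≡ red) (≤-antisym α<z (≤-pred z<α+2)) red₁
    ... | inj₂ refl  = red₂

  blueWindow : ∀ z → n * suc α ≤ a * z → a * z ≤ n * suc (suc α) → Good blue z ⊎ Solution
  blueWindow z lo hi = opposite redPair 1≤z z≤N lo hi
    where
    1≤z : 1 ≤ z
    1≤z = positive-factor a (≤-trans 1≤n (m≤m*n n (suc α))) lo
    z≤N : z ≤ N
    z≤N = ≤-trans (*-cancelˡ-≤ a (≤-trans hi (≤-trans (*-monoʳ-≤ n (n≤1+n (2 + α))) (≤-reflexive (*-comm n a))))) n≤N

  lowWindow : ∀ {z B} → z ≤ k + a → 3 ≤ B → a * z ≤ n * (B ∸ 1)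
  lowWindow {z} {B} z≤k+a 3≤B = begin
      a * z        ≤⟨ *-monoʳ-≤ a z≤k+a ⟩
      a * (k + a)  ≤⟨ a[k+a]≤2n ⟩
      2 * n        ≤⟨ *-monoˡ-≤ n (∸-monoˡ-≤ 1 3≤B) ⟩
      (B ∸ 1) * n  ≡⟨ *-comm (B ∸ 1) n ⟩
      n * (B ∸ 1)  ∎
    where open ≤-Reasoning

  -- cnt = n − (a − 1): the summands left beside a − 1 copies of y in a·y.
  cnt : ℕ
  cnt = n ∸ suc (suc α)

  lengths : suc (suc α) + cnt ≡ n
  lengths = m+[n∸m]≡n (≤-trans (n≤1+n (2 + α)) (<⇒≤ a<n))

  2n≤a·cnt : 2 * n ≤ a * cnt
  2n≤a·cnt = subst (λ t → 2 * t ≤ a * cnt) lengths (double-bound {a} {2 + α} {cnt} (s≤s (s≤s (s≤s z≤n))) 2[a-1]≤cnt)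
    where
    open ≤-Reasoning
    2[a-1]≤cnt : 2 * suc (suc α) ≤ cnt
    2[a-1]≤cnt = +-cancelˡ-≤ (2 + α) (2 * (2 + α)) cnt (begin
      3 * (2 + α)      ≤⟨ *-monoʳ-≤ 3 (n≤1+n (2 + α)) ⟩
      a + 2 * a        ≤⟨ +-monoʳ-≤ a 2a≤k ⟩
      a + k            ≡⟨ +-comm a k ⟩
      k + a            ≤⟨ k+a≤n ⟩
      n                ≡⟨ lengths ⟨
      2 + α + cnt      ∎)

  belowCount : ∀ {y B} → 3 ≤ B → a ≤ B → a * y < (n ∸ 1) * B + n + a → y ≤ cnt * (B ∸ 1)
  belowCount {y} {B} 3≤B a≤B ay< = *-cancelˡ-≤ a (≤-pred (begin
    suc (a * y)                ≤⟨ ay< ⟩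
    (n ∸ 1) * B + n + a        ≤⟨ tail-bound 1≤n 3≤B a≤B ⟩
    2 * n * (B ∸ 1) + 1        ≤⟨ +-monoˡ-≤ 1 (*-monoˡ-≤ (B ∸ 1) 2n≤a·cnt) ⟩
    a * cnt * (B ∸ 1) + 1      ≡⟨ cong (_+ 1) (*-assoc a cnt (B ∸ 1)) ⟩
    a * (cnt * (B ∸ 1)) + 1    ≡⟨ +-comm _ 1 ⟩
    suc (a * (cnt * (B ∸ 1)))  ∎))
    where open ≤-Reasoning

  -- If N is red, N is a sum of cnt
  -- numbers from [1, k − 1]; if N is blue, a·N is a sum of n numbers from
  -- [k, k + 1], all of which are blue since a·z ≤ n·(k − 1) there.
  noBlueBelow : (∀ z → Between 1 (k ∸ 1) z → c z ≡ red) → Solution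
  noBlueBelow allRed = [ redN , blueN ]′ (dichotomy (c N) red)
    where
    open ≤-Reasoning
    lowRed : Uniform red 1 (k ∸ 1)
    lowRed = uniform allRed ≤-refl (≤-trans (m∸n≤m k 1) (≤-trans (m≤m+n k a) k+a≤N))
    N≤cnt[k-1] : N ≤ cnt * (k ∸ 1)
    N≤cnt[k-1] = belowCount 3≤k a≤k (≤-trans N-upper (+-monoˡ-≤ a (drop-one-row n k k≤n)))
    redN : c N ≡ red → Solution
    redN N-red = selfSum refl lengths lowRed (1≤N , ≤-refl , N-red)
                   (≤-trans (≤-reflexive (*-identityʳ cnt)) (≤-trans (m∸n≤m n (2 + α)) n≤N)) N≤cnt[k-1]
    aN≤n[k+1] : a * N ≤ n * suc k
    aN≤n[k+1] = begin
      a * N        ≤⟨ <⇒≤ N-upper ⟩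
      n * k + a    ≤⟨ +-monoʳ-≤ (n * k) (<⇒≤ a<n) ⟩
      n * k + n    ≡⟨ +-comm (n * k) n ⟩
      n + n * k    ≡⟨ *-suc n k ⟨
      n * suc k    ∎
    blueNearK : ∀ z → Between k (suc k) z → Good blue z ⊎ Solution
    blueNearK z (k≤z , z≤1+k) =
      opposite lowRed (≤-trans 1≤k k≤z) (≤-trans z≤k+a k+a≤N)
        (≤-trans (≤-reflexive (*-identityʳ n)) (≤-trans k-lower (*-monoʳ-≤ a k≤z))) (lowWindow z≤k+a 3≤k)
      where
      z≤k+a : z ≤ k + a
      z≤k+a = ≤-trans z≤1+k (≤-trans (≤-reflexive (+-comm 1 k)) (+-monoʳ-≤ k (s≤s z≤n)))
    blueN : c N ≡ blue → Solution
    blueN N-blue = [ withSummands , id ]′ (refine blueNearK nearK)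
      where
      nearK : SumOf (Between k (suc k)) n (a * N)
      nearK = interval n N-lower aN≤n[k+1]
      withSummands : SumOf (Good blue) n (a * N) → Solution
      withSummands s = blue , N , (1≤N , ≤-refl , N-blue) , s

  -- Put y = ⌈((n − 1)·b + k)/a⌉ and v = a·y − (n − 1)·b ∈ [k, k + a).  A red v
  -- would be a sum of n red numbers from [1, b − 1]; so v is blue, and then
  -- either y is blue ((n − 1)·b + v = a·y) or y is red and a sum of cnt red
  -- numbers from [1, b − 1].
  module LargeFirstBlue (b : ℕ) (a≤b : a ≤ b) (b<k : b < k) (blue-b : c b ≡ blue)
                        (below : ∀ z → Between 1 (b ∸ 1) z → c z ≡ red) where
    open ≤-Reasoning

    b≤N : b ≤ N
    b≤N = ≤-trans (<⇒≤ b<k) (≤-trans (m≤m+n k a) k+a≤N)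

    3≤b : 3 ≤ b
    3≤b = ≤-trans (s≤s (s≤s (s≤s z≤n))) a≤b

    lowRed : Uniform red 1 (b ∸ 1)
    lowRed = uniform below ≤-refl (≤-trans (m∸n≤m b 1) b≤N)

    X : ℕ
    X = (n ∸ 1) * b + k

    y : ℕ
    y = ⌈ X / a ⌉

    X≤ay : X ≤ a * y
    X≤ay = proj₁ (ceil-spec X a)

    ay<X+a : a * y < X + a
    ay<X+a = proj₂ (ceil-spec X a)

    v : ℕ
    v = a * y ∸ (n ∸ 1) * b

    v-split : v + (n ∸ 1) * b ≡ a * y
    v-split = m∸n+n≡m (≤-trans (m≤m+n ((n ∸ 1) * b) k) X≤ay)

    k≤v : k ≤ v
    k≤v = +-cancelʳ-≤ ((n ∸ 1) * b) k v (begin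
      k + (n ∸ 1) * b  ≡⟨ +-comm k ((n ∸ 1) * b) ⟩
      X                ≤⟨ X≤ay ⟩
      a * y            ≡⟨ v-split ⟨
      v + (n ∸ 1) * b  ∎)

    v<k+a : v < k + a
    v<k+a = +-cancelʳ-< ((n ∸ 1) * b) v (k + a) (begin-strict
      v + (n ∸ 1) * b        ≡⟨ v-split ⟩
      a * y                  <⟨ ay<X+a ⟩
      (n ∸ 1) * b + k + a    ≡⟨ +-assoc ((n ∸ 1) * b) k a ⟩
      (n ∸ 1) * b + (k + a)  ≡⟨ +-comm ((n ∸ 1) * b) (k + a) ⟩
      k + a + (n ∸ 1) * b    ∎)

    1≤v : 1 ≤ v
    1≤v = ≤-trans 1≤k k≤v

    v≤N : v ≤ N
    v≤N = ≤-trans (<⇒≤ v<k+a) k+a≤N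

    1≤y : 1 ≤ y
    1≤y = positive-factor a (≤-trans 1≤k (m≤n+m k ((n ∸ 1) * b))) X≤ay

    y≤N : y ≤ N
    y≤N = <⇒≤ (*-cancelˡ-< a y N (begin-strict
      a * y    <⟨ ay<X+a ⟩
      X + a    ≤⟨ last-row b<k a<n ⟩
      n * k    ≤⟨ N-lower ⟩
      a * N    ∎))

    cnt≤y : cnt * 1 ≤ y
    cnt≤y = ≤-trans (≤-reflexive (*-identityʳ cnt)) (≤-trans (∸-monoʳ-≤ n (s≤s z≤n)) n-1≤y)
      where
      n-1≤y : n ∸ 1 ≤ y
      n-1≤y = *-cancelˡ-≤ a (begin
        a * (n ∸ 1)      ≤⟨ *-monoˡ-≤ (n ∸ 1) a≤b ⟩
        b * (n ∸ 1)      ≡⟨ *-comm b (n ∸ 1) ⟩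
        (n ∸ 1) * b      ≤⟨ m≤m+n ((n ∸ 1) * b) k ⟩
        X                ≤⟨ X≤ay ⟩
        a * y            ∎)

    y≤cnt[b-1] : y ≤ cnt * (b ∸ 1)
    y≤cnt[b-1] = belowCount 3≤b a≤b (≤-trans ay<X+a (+-monoˡ-≤ a (+-monoʳ-≤ ((n ∸ 1) * b) k≤n)))

    redV : c v ≡ red → Solution
    redV v-red = forced lowRed (1≤v , v≤N , v-red)
                   (≤-trans (≤-reflexive (*-identityʳ n)) (≤-trans k-lower (*-monoʳ-≤ a k≤v)))
                   (lowWindow (<⇒≤ v<k+a) 3≤b)

    blueV : c v ≡ blue → Solution
    blueV v-blue = [ redY , blueY ]′ (dichotomy (c y) red)
      where
      redY : c y ≡ red → Solution
      redY y-red = selfSum refl lengths lowRed (1≤y , y≤N , y-red) cnt≤y y≤cnt[b-1]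
      copies : SumOf (Good blue) ((n ∸ 1) + 1) ((n ∸ 1) * b + (v + 0))
      copies = replicate (n ∸ 1) (≤-trans (s≤s z≤n) 3≤b , b≤N , blue-b) ++ cons v (1≤v , v≤N , v-blue) []
      blueY : c y ≡ blue → Solution
      blueY y-blue = blue , y , (1≤y , y≤N , y-blue) ,
        castSum (m∸n+n≡m 1≤n) (trans (cong ((n ∸ 1) * b +_) (+-identityʳ v)) (trans (+-comm ((n ∸ 1) * b) v) v-split)) copies

    solution : Solution
    solution = [ redV , blueV ]′ (dichotomy (c v) red)

  -- Case 3: some blue b satisfies 1 ≤ b ≤ a − 3.  Put p = a − 1 − b,
  -- w = n − k, u = n − 2k + 2 and y = ⌊((n − p)·b + p·w)/a⌋.  Every number in
  -- [u, w], and y itself, lies in the blue window of step 0, and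
  -- a·y − (n − p)·b is a sum of p numbers from [u, w].
  module SmallBlue (b : ℕ) (1≤b : 1 ≤ b) (b+3≤a : b + 3 ≤ a) (blue-b : c b ≡ blue) where
    open ≤-Reasoning

    b≤α : b ≤ α
    b≤α = +-cancelʳ-≤ 3 b α (≤-trans b+3≤a (≤-reflexive (+-comm 3 α)))

    b≤N : b ≤ N
    b≤N = ≤-trans (≤-trans b≤α (m≤n+m α 3)) a≤N

    r : ℕ
    r = suc (α ∸ b)

    p : ℕ
    p = suc r

    b+r≡1+α : b + r ≡ suc α
    b+r≡1+α = trans (+-suc b (α ∸ b)) (cong suc (m+[n∸m]≡n b≤α))

    b+p≡a-1 : b + p ≡ suc (suc α)
    b+p≡a-1 = trans (+-suc b r) (cong suc b+r≡1+α)

    p≤a : p ≤ a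
    p≤a = s≤s (s≤s (≤-trans (m∸n≤m α b) (n≤1+n α)))

    p≤n : p ≤ n
    p≤n = ≤-trans p≤a (<⇒≤ a<n)

    w : ℕ
    w = n ∸ k

    w+k≡n : w + k ≡ n
    w+k≡n = m∸n+n≡m k≤n

    k≤w : k ≤ w
    k≤w = +-cancelʳ-≤ k k w (≤-trans 2k≤n (≤-reflexive (sym w+k≡n)))
      where
      2k≤n : k + k ≤ n
      2k≤n = <⇒≤ (+-cancelʳ-< k (k + k) n (begin-strict
        k + k + k          ≡⟨ +-assoc k k k ⟩
        k + (k + k)        ≡⟨ cong (λ t → k + (k + t)) (+-identityʳ k) ⟨
        3 * k              ≤⟨ *-monoˡ-≤ k (m≤m+n 3 α) ⟩
        a * k              <⟨ k-upper ⟩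
        n + a              ≤⟨ +-monoʳ-≤ n a≤k ⟩
        n + k              ∎))

    u : ℕ
    u = suc (suc (w ∸ k))

    u+k≡2+w : u + k ≡ 2 + w
    u+k≡2+w = cong (2 +_) (m∸n+n≡m k≤w)

    window-u : n * suc α ≤ a * u
    window-u = +-cancelʳ-≤ (2 * (a * k)) (n * suc α) (a * u) (begin
      n * suc α + 2 * (a * k)  ≤⟨ +-monoʳ-≤ (n * suc α) (*-monoʳ-≤ 2 (<⇒≤ k-upper)) ⟩
      n * suc α + 2 * (n + a)  ≡⟨ spread α n ⟩
      a * (n + 2)              ≡⟨ cong (a *_) (+-comm n 2) ⟩
      a * (2 + n)              ≡⟨ cong (λ t → a * (2 + t)) w+k≡n ⟨
      a * (2 + w + k)          ≡⟨ cong (λ t → a * (t + k)) u+k≡2+w ⟨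
      a * (u + k + k)          ≡⟨ collect a u k ⟩
      a * u + 2 * (a * k)      ∎)
      where
      spread : ∀ α n → n * suc α + 2 * (n + (3 + α)) ≡ (3 + α) * (n + 2)
      spread = solve-∀
      collect : ∀ a u k → a * (u + k + k) ≡ a * u + 2 * (a * k)
      collect = solve-∀

    window-w : a * w ≤ n * suc (suc α)
    window-w = +-cancelʳ-≤ n (a * w) (n * suc (suc α)) (begin
      a * w + n              ≤⟨ +-monoʳ-≤ (a * w) k-lower ⟩
      a * w + a * k          ≡⟨ *-distribˡ-+ a w k ⟨
      a * (w + k)            ≡⟨ cong (a *_) w+k≡n ⟩
      n + suc (suc α) * n    ≡⟨ +-comm n (suc (suc α) * n) ⟩
      suc (suc α) * n + n    ≡⟨ cong (_+ n) (*-comm (suc (suc α)) n) ⟩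
      n * suc (suc α) + n    ∎)

    blueSummand : ∀ z → Between u w z → Good blue z ⊎ Solution
    blueSummand z (u≤z , z≤w) = blueWindow z (≤-trans window-u (*-monoʳ-≤ a u≤z)) (≤-trans (*-monoʳ-≤ a z≤w) window-w)

    bulk : ℕ
    bulk = (n ∸ p) * b

    S : ℕ
    S = bulk + p * w

    y : ℕ
    y = S / a

    ay≤S : a * y ≤ S
    ay≤S = proj₁ (floor-spec S a)

    S<ay+a : S < a * y + a
    S<ay+a = proj₂ (floor-spec S a)

    S≤n[a-1] : S ≤ n * suc (suc α)
    S≤n[a-1] = begin
      bulk + p * w      ≤⟨ +-mono-≤ (*-monoˡ-≤ b (m∸n≤m n p)) (*-monoʳ-≤ p (m∸n≤m n k)) ⟩
      n * b + p * n     ≡⟨ cong (n * b +_) (*-comm p n) ⟩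
      n * b + n * p     ≡⟨ *-distribˡ-+ n b p ⟨
      n * (b + p)       ≡⟨ cong (n *_) b+p≡a-1 ⟩
      n * suc (suc α)   ∎

    n[a-2]+[a-1]≤S : n * suc α + suc (suc α) ≤ S
    n[a-2]+[a-1]≤S = *-cancelˡ-≤ a (+-cancelʳ-≤ (p * (n + suc (suc α))) _ _ (begin
      a * (n * suc α + suc (suc α)) + p * (n + suc (suc α))
        ≤⟨ balance {suc α} {b} {r} {n} {n ∸ p} b+r≡1+α (m∸n+n≡m p≤n) 2a[a-1]≤n ⟩
      a * bulk + p * (a * n)
        ≡⟨ cong (λ t → a * bulk + p * (a * t)) w+k≡n ⟨
      a * bulk + p * (a * (w + k))
        ≡⟨ cong (λ t → a * bulk + p * t) (*-distribˡ-+ a w k) ⟩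
      a * bulk + p * (a * w + a * k)
        ≤⟨ +-monoʳ-≤ (a * bulk) (*-monoʳ-≤ p (+-monoʳ-≤ (a * w) ak≤n+a-1)) ⟩
      a * bulk + p * (a * w + (n + suc (suc α)))
        ≡⟨ regroup a bulk p w (n + suc (suc α)) ⟩
      a * S + p * (n + suc (suc α))  ∎))
      where
      ak≤n+a-1 : a * k ≤ n + suc (suc α)
      ak≤n+a-1 = ≤-pred (≤-trans k-upper (≤-reflexive (+-suc n (suc (suc α)))))
      regroup : ∀ a B p w Q → a * B + p * (a * w + Q) ≡ a * (B + p * w) + p * Q
      regroup = solve-∀

    window-y : n * suc α ≤ a * y
    window-y = +-cancelʳ-≤ a (n * suc α) (a * y) (begin
      n * suc α + a                     ≡⟨ +-suc (n * suc α) (suc (suc α)) ⟩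
      suc (n * suc α + suc (suc α))     ≤⟨ s≤s n[a-2]+[a-1]≤S ⟩
      suc S                             ≤⟨ S<ay+a ⟩
      a * y + a                         ∎)

    pu+a≤pw : p * u + a ≤ p * w
    pu+a≤pw = +-cancelʳ-≤ (2 * p) (p * u + a) (p * w) (begin
      p * u + a + 2 * p      ≡⟨ +-assoc (p * u) a (2 * p) ⟩
      p * u + (a + 2 * p)    ≤⟨ +-monoʳ-≤ (p * u) a+2p≤pk ⟩
      p * u + p * k          ≡⟨ *-distribˡ-+ p u k ⟨
      p * (u + k)            ≡⟨ cong (p *_) u+k≡2+w ⟩
      p * (2 + w)            ≡⟨ *-distribˡ-+ p 2 w ⟩
      p * 2 + p * w          ≡⟨ +-comm (p * 2) (p * w) ⟩
      p * w + p * 2          ≡⟨ cong (p * w +_) (*-comm p 2) ⟩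
      p * w + 2 * p          ∎)
      where
      a+2p≤pk : a + 2 * p ≤ p * k
      a+2p≤pk = begin
        a + 2 * p        ≤⟨ +-monoʳ-≤ a (*-monoʳ-≤ 2 p≤a) ⟩
        a + 2 * a        ≤⟨ +-monoˡ-≤ (2 * a) (m≤m+n a (a + 0)) ⟩
        2 * a + 2 * a    ≤⟨ +-mono-≤ 2a≤k 2a≤k ⟩
        k + k            ≡⟨ cong (k +_) (+-identityʳ k) ⟨
        2 * k            ≤⟨ *-monoˡ-≤ k {2} {p} (s≤s (s≤s z≤n)) ⟩
        p * k            ∎

    bulk+pu<ay : bulk + p * u < a * y
    bulk+pu<ay = +-cancelʳ-< a (bulk + p * u) (a * y) (begin-strict
      bulk + p * u + a      ≡⟨ +-assoc bulk (p * u) a ⟩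
      bulk + (p * u + a)    ≤⟨ +-monoʳ-≤ bulk pu+a≤pw ⟩
      S                     <⟨ S<ay+a ⟩
      a * y + a             ∎)

    bulk≤ay : bulk ≤ a * y
    bulk≤ay = ≤-trans (m≤m+n bulk (p * u)) (<⇒≤ bulk+pu<ay)

    T : ℕ
    T = a * y ∸ bulk

    pu≤T : p * u ≤ T
    pu≤T = m+n≤o⇒m≤o∸n (p * u) (≤-trans (≤-reflexive (+-comm (p * u) bulk)) (<⇒≤ bulk+pu<ay))

    T≤pw : T ≤ p * w
    T≤pw = m≤n+o⇒m∸n≤o (a * y) bulk ay≤S

    solution : Solution
    solution = [ blueY , id ]′ (blueWindow y window-y (≤-trans ay≤S S≤n[a-1]))
      where
      blueY : Good blue y → Solution
      blueY good-y = [ withSummands , id ]′ (refine blueSummand remainder)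
        where
        remainder : SumOf (Between u w) p T
        remainder = interval p pu≤T T≤pw
        withSummands : SumOf (Good blue) p T → Solution
        withSummands s = blue , y , good-y ,
          castSum (m∸n+n≡m p≤n) (m+[n∸m]≡n bulk≤ay) (replicate (n ∸ p) (1≤b , b≤N , blue-b) ++ s)

  -- Cases 1–3 are exhaustive: a blue b below a − 2 is at most a − 3, while
  -- a − 2 and a − 1 themselves are red.
  result : Solution
  result with firstBlue (k ∸ 1)
  ... | inj₁ allRed = noBlueBelow allRed
  ... | inj₂ (b , (1≤b , b≤k-1) , blue-b , below) with a ≤? b | b + 3 ≤? a
  ...   | yes a≤b | _         = LargeFirstBlue.solution b a≤b (below-pred 1≤k b≤k-1) blue-b below
  ...   | no _    | yes b+3≤a = SmallBlue.solution b 1≤b b+3≤a blue-b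
  ...   | no a≰b  | no b+3≰a  = contradiction (trans (sym blue-b) (proj₂ (proj₂ (redPair b (a-2≤b , b≤a-1))))) λ ()
    where
    b≤a-1 : b ≤ suc (suc α)
    b≤a-1 = ≤-pred (≰⇒> a≰b)
    a-2≤b : suc α ≤ b
    a-2≤b = +-cancelʳ-≤ 3 (suc α) b (≤-trans (≤-reflexive (+-comm (suc α) 3)) (≰⇒> b+3≰a))

proposition3 : (a m : ℕ) → .{{_ : NonZero a}} → 3 ≤ a → 2 * a * a ∸ a + 2 ≤ m →
    (c : ℕ → Colour) → c (a ∸ 2) ≡ red → c (a ∸ 1) ≡ red →
    MonoSolution (C m a) m a c
proposition3 a@(suc (suc (suc α))) m (s≤s (s≤s (s≤s z≤n))) m-large c red₁ red₂ =
  toMonoSolution {C m a} {m} {a} {c} (Main.result α n k (C m a) c n-large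
                   (proj₁ (ceil-spec n a)) (proj₂ (ceil-spec n a))
                   (proj₁ (ceil-spec (n * k) a)) (proj₂ (ceil-spec (n * k) a)) red₁ red₂)
  where
  n : ℕ
  n = m ∸ 1
  k : ℕ
  k = ⌈ n / a ⌉
  n-large : 2 * a * a + 1 ≤ n + a
  n-large = shift-bound (m≤n*m a (2 * a)) m-large
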